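{- Let $b, m$ be positive integers with $b \mid m$, and let $d_1, \dots, d_b$ be odd integers with $3 \le d_j \le 2m-3$. Let $G$ be the graph on vertex set $\{1, 2, \dots, 2m\}$ whose edges are the Hamiltonian cycle edges $\{x, x+1\}$ for $1 \le x \le 2m-1$ together with $\{2m, 1\}$, and, for each odd vertex $x = 2i-1$ ($1 \le i \le m$), the chord joining $x$ to the even vertex $c(x) \in \{1,\dots,2m\}$ with $c(x) \equiv x + d_j \pmod{2m}$, where $j \in \{1,\dots,b\}$ satisfies $j \equiv i \pmod b$. Assume $G$ is a simple $3$-regular graph (so it is a Hamiltonian trivalent bipartite graph with symmetry factor $b$ and D3 chord indices $d_1,\dots,d_b$). For each $h \in \{1, \dots, 2b\}$ let $T_h$ be the breadth-first traversal tree of $G$ from $h$: its root is labelled $h$ (depth $0$); the children of the root are nodes labelled by the three neighbours of $h$; and a node at depth $\ge 1$ labelled $x$ whose parent is labelled $y$ has as children nodes labelled by the two neighbours of $x$ other than $y$. Let $t_h$ be the smallest depth at which some node of $T_h$ carries a label $a$ that also occurs at a different node of $T_h$ of depth at most $t_h$, and let $L(h)$ be the minimum, over all such labels $a$ occurring (repeated) at depth $t_h$, of $s_a + t_h$, where $s_a$ is the smallest depth of a node of $T_h$ labelled $a$. Then the girth of $G$ equals $\min_{1 \le h \le 2b} L(h)$.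
   Context: The girth of a graph is the length of its shortest cycle. In the paper, a Hamiltonian trivalent bipartite graph (HBG) of order $2m$ with symmetry factor $b$ is specified by "D3 chord indices" $d_1,\dots,d_b$ exactly as in the construction described in the claim: vertices $1,\dots,2m$ form the Hamiltonian cycle $1\to 2\to\cdots\to 2m\to 1$, and each odd vertex $2i-1$ has one further edge (a chord) to the vertex congruent to $2i-1+d_j$ modulo $2m$ (taken in $\{1,\dots,2m\}$), with $j\equiv i \pmod b$. A label repeating in $T_h$ corresponds to a cycle of length $s_a+t_h$ in $G$. -}

module Defs where

open import Data.Nat using (ℕ; zero; suc; _+_; _*_; _∸_; _≤_; _<_)
open import Data.Nat.DivMod using (_%_; _/_)
open import Data.List using (List; []; _∷_; length)
open import Data.Unit using (⊤)
open import Data.Empty using (⊥)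
open import Data.Product using (_×_; ∃-syntax)
open import Data.Sum using (_⊎_)
open import Relation.Binary.PropositionalEquality using (_≡_; _≢_)

-- remainder modulo n (only ever used with n ≥ 1; junk value for n = 0)
modN : ℕ → ℕ → ℕ
modN n zero    = n
modN n (suc k) = n % suc k

OddN : ℕ → Set
OddN x = x % 2 ≡ 1

InV : ℕ → ℕ → Set
InV m x = 1 ≤ x × x ≤ 2 * m

-- for odd x = 2i-1 (so i-1 = x / 2): the index j ∈ {1..b} with j ≡ i (mod b)
chordIndex : ℕ → ℕ → ℕ
chordIndex b x = modN (x / 2) b + 1

-- c(x) ∈ {1..2m} with c(x) ≡ x + d_j (mod 2m)
chord : ℕ → ℕ → (ℕ → ℕ) → ℕ → ℕ
chord m b d x = modN (x + d (chordIndex b x) ∸ 1) (2 * m) + 1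

-- directed form of a Hamiltonian-cycle edge {x, x+1} (1 ≤ x ≤ 2m-1) or {2m, 1}
CycE : ℕ → ℕ → ℕ → Set
CycE m x y = (y ≡ suc x) ⊎ (x ≡ 2 * m × y ≡ 1)

ChordE : ℕ → ℕ → (ℕ → ℕ) → ℕ → ℕ → Set
ChordE m b d x y = OddN x × y ≡ chord m b d x

Adj : ℕ → ℕ → (ℕ → ℕ) → ℕ → ℕ → Set
Adj m b d x y = InV m x × InV m y ×
  (CycE m x y ⊎ CycE m y x ⊎ ChordE m b d x y ⊎ ChordE m b d y x)

Cubic : ℕ → ℕ → (ℕ → ℕ) → Set
Cubic m b d = ∀ v → InV m v →
  ∃[ u₁ ] ∃[ u₂ ] ∃[ u₃ ] (u₁ ≢ u₂ × u₁ ≢ u₃ × u₂ ≢ u₃ ×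
    Adj m b d v u₁ × Adj m b d v u₂ × Adj m b d v u₃ ×
    (∀ w → Adj m b d v w → w ≡ u₁ ⊎ w ≡ u₂ ⊎ w ≡ u₃))

IsLeast : (ℕ → Set) → ℕ → Set
IsLeast P n = P n × (∀ k → P k → n ≤ k)

IsCycle : ℕ → ℕ → (ℕ → ℕ) → ℕ → (ℕ → ℕ) → Set
IsCycle m b d k w = 3 ≤ k × w k ≡ w 0 ×
  (∀ i → i < k → Adj m b d (w i) (w (suc i))) ×
  (∀ i j → i < j → j < k → w i ≢ w j)

HasCycleOfLength : ℕ → ℕ → (ℕ → ℕ) → ℕ → Set
HasCycleOfLength m b d k = ∃[ w ] IsCycle m b d k w

IsGirth : ℕ → ℕ → (ℕ → ℕ) → ℕ → Set
IsGirth m b d = IsLeast (HasCycleOfLength m b d)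

-- A node of T_h is identified with the
-- (reversed) list of labels on the path from the root to it:
-- x_t ∷ x_{t-1} ∷ … ∷ x_0 with x_0 = h.
NoBack : ℕ → List ℕ → Set
NoBack x []      = ⊤
NoBack x (z ∷ _) = x ≢ z

IsNode : ℕ → ℕ → (ℕ → ℕ) → ℕ → List ℕ → Set
IsNode m b d h []            = ⊥
IsNode m b d h (x ∷ [])      = x ≡ h
IsNode m b d h (x ∷ y ∷ rest) =
  Adj m b d y x × NoBack x rest × IsNode m b d h (y ∷ rest)

depth : List ℕ → ℕ
depth p = length p ∸ 1

NodeAt : ℕ → ℕ → (ℕ → ℕ) → ℕ → ℕ → ℕ → List ℕ → Set
NodeAt m b d h t a p = IsNode m b d h p × depth p ≡ t × (∃[ rest ] p ≡ a ∷ rest)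

Repeated : ℕ → ℕ → (ℕ → ℕ) → ℕ → ℕ → ℕ → Set
Repeated m b d h t a = ∃[ p ] ∃[ q ] ∃[ t' ]
  (NodeAt m b d h t a p × NodeAt m b d h t' a q × t' ≤ t × p ≢ q)

IsTh : ℕ → ℕ → (ℕ → ℕ) → ℕ → ℕ → Set
IsTh m b d h = IsLeast (λ t → ∃[ a ] Repeated m b d h t a)

IsSa : ℕ → ℕ → (ℕ → ℕ) → ℕ → ℕ → ℕ → Set
IsSa m b d h a = IsLeast (λ s → ∃[ p ] NodeAt m b d h s a p)

IsL : ℕ → ℕ → (ℕ → ℕ) → ℕ → ℕ → Set
IsL m b d h ℓ = ∃[ t ] (IsTh m b d h t ×
  IsLeast (λ ℓ' → ∃[ a ] ∃[ s ] (Repeated m b d h t a × IsSa m b d h a s × ℓ' ≡ s + t)) ℓ)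

module Submission where

-- A node of the traversal tree T_h is a non-backtracking walk from h, labelled by its endpoint.
-- Two distinct nodes with a common label a at depths t ≥ s thus give two such walks from h to a;
-- when t = t_h is the first depth at which a label repeats, their last steps differ, so one walk
-- followed by the reverse of the other is a closed non-backtracking walk, and its first
-- self-intersection is a cycle of length at most s + t.  Hence G has a cycle of length at most L(h).
-- Conversely, the two halves of a cycle of length k through h are tree paths of lengths ⌊k/2⌋ and
-- ⌈k/2⌉ ending in the same label, so L(h) ≤ k.  As b ∣ m, the chord pattern has period 2b and
-- subtracting a multiple of 2b is an automorphism of G, so every cycle is mapped to one through a
-- vertex of {1, …, 2b}; the Hamiltonian cycle makes every L(h) defined.

open import Defs
open import Data.Nat
open import Data.Nat.Properties
open import Algebra.Properties.CommutativeSemigroup +-commutativeSemigroup using (xy∙z≈xz∙y)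
open import Data.Nat.DivMod
open import Data.Nat.Divisibility using (_∣_; ∣⇒≤; m∣m*n; n∣m*n; *-monoˡ-∣)
open import Data.List using (List; []; _∷_; length)
import Data.List.Properties as List
open import Data.Product
open import Data.Sum using (_⊎_; inj₁; inj₂)
open import Data.Empty using (⊥; ⊥-elim)
open import Data.Unit using (tt)
open import Function using (_∘_)
open import Relation.Binary using (IsEquivalence; Setoid)
open import Relation.Binary.PropositionalEquality
open import Relation.Nullary using (Dec; yes; no; ¬_; ¬?)
open import Relation.Nullary.Decidable using (_×-dec_; _⊎-dec_; map′)
import Relation.Binary.Reasoning.Setoid as SetoidReasoning

module _ {P : ℕ → Set} (P? : ∀ n → Dec (P n)) where

  private
    leastBelow : ∀ n → (∃ λ k → k < n × P k) → ∃ (IsLeast P)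
    leastBelow (suc n) (k , k<1+n , Pk) with anyUpTo? P? n
    ... | yes below = leastBelow n below
    ... | no none = k , Pk , λ j Pj → ≮⇒≥ λ j<k → none (j , <-≤-trans j<k (≤-pred k<1+n) , Pj)

  least-exists : ∀ {n} → P n → ∃ (IsLeast P)
  least-exists {n} Pn = leastBelow (suc n) (n , ≤-refl , Pn)

  isLeast? : ∀ n → Dec (IsLeast P n)
  isLeast? n = map′
    (λ (Pn , none) → Pn , λ k Pk → ≮⇒≥ λ k<n → none (k , k<n , Pk))
    (λ (Pn , least) → Pn , λ (k , k<n , Pk) → <⇒≱ k<n (least k Pk))
    (P? n ×-dec ¬? (anyUpTo? P? n))

  ∃-bounded? : ∀ M → (∀ n → P n → n ≤ M) → Dec (∃ P)
  ∃-bounded? M bound = map′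
    (λ (n , _ , Pn) → n , Pn)
    (λ (n , Pn) → n , s≤s (bound n Pn) , Pn)
    (anyUpTo? P? (suc M))

IsLeast-unique : ∀ {P : ℕ → Set} {m n} → IsLeast P m → IsLeast P n → m ≡ n
IsLeast-unique (Pm , m-least) (Pn , n-least) = ≤-antisym (m-least _ Pn) (n-least _ Pm)

module Congruence (N : ℕ) .{{_ : NonZero N}} where

  -- A record rather than a synonym, so that both sides are recoverable from the type.
  infix 4 _≈_
  record _≈_ (x y : ℕ) : Set where
    constructor mod-≡
    field %-≡ : x % N ≡ y % N

  ≈-isEquivalence : IsEquivalence _≈_
  ≈-isEquivalence = record
    { refl  = mod-≡ refl
    ; sym   = λ (mod-≡ e) → mod-≡ (sym e)
    ; trans = λ (mod-≡ e) (mod-≡ f) → mod-≡ (trans e f)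
    }

  ≈-setoid : Setoid _ _
  ≈-setoid = record { isEquivalence = ≈-isEquivalence }

  open IsEquivalence ≈-isEquivalence public
    using () renaming (refl to ≈-refl; sym to ≈-sym; trans to ≈-trans)
  module ≈-Reasoning = SetoidReasoning ≈-setoid

  ≡⇒≈ : ∀ {x y} → x ≡ y → x ≈ y
  ≡⇒≈ refl = ≈-refl

  +-congʳ : ∀ {x y} z → x ≈ y → x + z ≈ y + z
  +-congʳ {x} {y} z (mod-≡ e) = mod-≡ (begin
    (x + z) % N           ≡⟨ %-distribˡ-+ x z N ⟩
    (x % N + z % N) % N   ≡⟨ cong (λ u → (u + z % N) % N) e ⟩
    (y % N + z % N) % N   ≡⟨ %-distribˡ-+ y z N ⟨
    (y + z) % N           ∎)
    where open ≡-Reasoning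

  +N≈ : ∀ x → x + N ≈ x
  +N≈ x = mod-≡ ([m+n]%n≡m%n x N)

  +*N≈ : ∀ x k → x + k * N ≈ x
  +*N≈ x k = mod-≡ ([m+kn]%n≡m%n x k N)

  +*N-split : ∀ u z → u + z * N ≡ u + z + z * (N ∸ 1)
  +*N-split u z = begin
    u + z * N                 ≡⟨ cong (λ n → u + z * n) (suc-pred N) ⟨
    u + z * suc (N ∸ 1)       ≡⟨ cong (u +_) (*-suc z (N ∸ 1)) ⟩
    u + (z + z * (N ∸ 1))     ≡⟨ +-assoc u z _ ⟨
    u + z + z * (N ∸ 1)       ∎
    where open ≡-Reasoning

  -- Adding z * (N ∸ 1) turns + z into + z * N, which vanishes modulo N.
  +-cancelʳ : ∀ {x y} z → x + z ≈ y + z → x ≈ y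
  +-cancelʳ {x} {y} z x+z≈y+z = begin
    x                       ≈⟨ +*N≈ x z ⟨
    x + z * N               ≡⟨ +*N-split x z ⟩
    x + z + z * (N ∸ 1)     ≈⟨ +-congʳ (z * (N ∸ 1)) x+z≈y+z ⟩
    y + z + z * (N ∸ 1)     ≡⟨ +*N-split y z ⟨
    y + z * N               ≈⟨ +*N≈ y z ⟩
    y                       ∎
    where open ≈-Reasoning

  <N⇒≈⇒≡ : ∀ {x y} → x < N → y < N → x ≈ y → x ≡ y
  <N⇒≈⇒≡ x<N y<N (mod-≡ e) = trans (sym (m<n⇒m%n≡m x<N)) (trans e (m<n⇒m%n≡m y<N))

  InR : ℕ → Set
  InR x = 1 ≤ x × x ≤ N

  ≈⇒≡ : ∀ {x y} → InR x → InR y → x ≈ y → x ≡ y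
  ≈⇒≡ {suc x} {suc y} (_ , x<N) (_ , y<N) e =
    cong suc (<N⇒≈⇒≡ x<N y<N (+-cancelʳ 1 (subst₂ _≈_ (+-comm 1 x) (+-comm 1 y) e)))

  rep : ℕ → ℕ
  rep y = (y ∸ 1) % N + 1

  rep-InR : ∀ y → InR (rep y)
  rep-InR y = m≤n+m 1 _ , subst (_≤ N) (+-comm 1 _) (m%n<n (y ∸ 1) N)

  rep≈ : ∀ {y} → 1 ≤ y → rep y ≈ y
  rep≈ {suc y} _ = subst (y % N + 1 ≈_) (+-comm y 1) (+-congʳ 1 (mod-≡ (m%n%n≡m%n y N)))

  cyclicStep⇒≈ : ∀ {x y} → y ≡ suc x ⊎ (x ≡ N × y ≡ 1) → x + 1 ≈ y
  cyclicStep⇒≈ {x} (inj₁ refl)          = ≡⇒≈ (+-comm x 1)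
  cyclicStep⇒≈     (inj₂ (refl , refl)) = ≈-trans (≡⇒≈ (+-comm N 1)) (+N≈ 1)

  ≈⇒cyclicStep : ∀ {x y} → InR x → InR y → x + 1 ≈ y → y ≡ suc x ⊎ (x ≡ N × y ≡ 1)
  ≈⇒cyclicStep {x} {y} (1≤x , x≤N) y∈ x+1≈y with m≤n⇒m<n∨m≡n x≤N
  ... | inj₁ x<N  = inj₁ (sym (≈⇒≡ (s≤s z≤n , x<N) y∈ (≈-trans (≡⇒≈ (+-comm 1 x)) x+1≈y)))
  ... | inj₂ refl = inj₂ (refl , sym (≈⇒≡ (s≤s z≤n , 1≤x) y∈
                                   (≈-trans (≈-sym (cyclicStep⇒≈ (inj₂ (refl , refl)))) x+1≈y)))

-- ancestor (x_t ∷ … ∷ x_0) i = x_i: labels of a tree node are indexed from the root.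
ancestor : List ℕ → ℕ → ℕ
ancestor []         _ = 0
ancestor (x ∷ rest) i with length rest ≤? i
... | yes _ = x
... | no  _ = ancestor rest i

ancestor-last : ∀ x rest → ancestor (x ∷ rest) (length rest) ≡ x
ancestor-last x rest with length rest ≤? length rest
... | yes _   = refl
... | no  len≰len = ⊥-elim (len≰len ≤-refl)

ancestor-∷ : ∀ x rest {i} → i < length rest → ancestor (x ∷ rest) i ≡ ancestor rest i
ancestor-∷ x rest {i} i<len with length rest ≤? i
... | yes len≤i = ⊥-elim (<⇒≱ i<len len≤i)
... | no  _     = refl

walkNode : (ℕ → ℕ) → ℕ → List ℕ
walkNodeTail : (ℕ → ℕ) → ℕ → List ℕ
walkNode f t = f t ∷ walkNodeTail f t
walkNodeTail f zero    = []
walkNodeTail f (suc t) = walkNode f t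

walkNode-depth : ∀ f t → depth (walkNode f t) ≡ t
walkNode-depth f zero    = refl
walkNode-depth f (suc t) = cong suc (walkNode-depth f t)

walkNode-injective : ∀ {f g} t → walkNode f t ≡ walkNode g t → ∀ i → i ≤ t → f i ≡ g i
walkNode-injective zero    eq .zero z≤n = List.∷-injectiveˡ eq
walkNode-injective (suc t) eq i i≤1+t with m≤n⇒m<n∨m≡n i≤1+t
... | inj₁ i<1+t = walkNode-injective t (List.∷-injectiveʳ eq) i (≤-pred i<1+t)
... | inj₂ refl  = List.∷-injectiveˡ eq

module _ {m b : ℕ} {d : ℕ → ℕ} where

  Adj-sym : ∀ {x y} → Adj m b d x y → Adj m b d y x
  Adj-sym (x∈ , y∈ , inj₁ e)                = y∈ , x∈ , inj₂ (inj₁ e)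
  Adj-sym (x∈ , y∈ , inj₂ (inj₁ e))         = y∈ , x∈ , inj₁ e
  Adj-sym (x∈ , y∈ , inj₂ (inj₂ (inj₁ e)))  = y∈ , x∈ , inj₂ (inj₂ (inj₂ e))
  Adj-sym (x∈ , y∈ , inj₂ (inj₂ (inj₂ e)))  = y∈ , x∈ , inj₂ (inj₂ (inj₁ e))

  Adj? : ∀ x y → Dec (Adj m b d x y)
  Adj? x y = InV? x ×-dec InV? y ×-dec (CycE? x y ⊎-dec CycE? y x ⊎-dec ChordE? x y ⊎-dec ChordE? y x)
    where
    InV? : ∀ x → Dec (InV m x)
    InV? x = 1 ≤? x ×-dec x ≤? 2 * m
    CycE? : ∀ x y → Dec (CycE m x y)
    CycE? x y = y ≟ suc x ⊎-dec (x ≟ 2 * m ×-dec y ≟ 1)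
    ChordE? : ∀ x y → Dec (ChordE m b d x y)
    ChordE? x y = x % 2 ≟ 1 ×-dec y ≟ chord m b d x

  IsCycle-map : ∀ {k w} (f : ℕ → ℕ) →
    (∀ {x y} → Adj m b d x y → Adj m b d (f x) (f y)) →
    (∀ {x y} → InV m x → InV m y → f x ≡ f y → x ≡ y) →
    IsCycle m b d k w → IsCycle m b d k (f ∘ w)
  IsCycle-map f f-Adj f-injective (3≤k , closed , step , distinct) =
    3≤k , cong f closed , (λ i i<k → f-Adj (step i i<k)) ,
    λ i j i<j j<k fwi≡fwj → distinct i j i<j j<k
      (f-injective (proj₁ (step i (<-trans i<j j<k))) (proj₁ (step j j<k)) fwi≡fwj)

module Walks (m b : ℕ) (d : ℕ → ℕ) (Adj-irrefl : ∀ {x} → ¬ Adj m b d x x) where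

  infix 4 _~_
  _~_ : ℕ → ℕ → Set
  _~_ = Adj m b d

  ~-sym : ∀ {x y} → x ~ y → y ~ x
  ~-sym = Adj-sym {m} {b} {d}

  _~?_ : ∀ x y → Dec (x ~ y)
  _~?_ = Adj? {m} {b} {d}

  record NonBacktracking (h t : ℕ) (f : ℕ → ℕ) : Set where
    field
      start  : f 0 ≡ h
      step   : ∀ i → i < t → f i ~ f (suc i)
      noBack : ∀ i → 2 + i ≤ t → f (2 + i) ≢ f i
  open NonBacktracking

  shorten : ∀ {h t t' f} → t' ≤ t → NonBacktracking h t f → NonBacktracking h t' f
  shorten t'≤t walk = record
    { start  = start walk
    ; step   = λ i i<t' → step walk i (<-≤-trans i<t' t'≤t)
    ; noBack = λ i 2+i≤t' → noBack walk i (≤-trans 2+i≤t' t'≤t)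
    }

  extend : ∀ {h t f g} → NonBacktracking h t f → (∀ i → i ≤ t → g i ≡ f i) →
           f t ~ g (suc t) → (∀ t' → t ≡ suc t' → g (suc t) ≢ f t') →
           NonBacktracking h (suc t) g
  extend {t = t} {f} {g} walk g≡f last-step last-noBack = record
    { start  = trans (g≡f 0 z≤n) (start walk)
    ; step   = step′
    ; noBack = noBack′
    }
    where
    step′ : ∀ i → i < suc t → g i ~ g (suc i)
    step′ i i<1+t with m<1+n⇒m<n∨m≡n i<1+t
    ... | inj₁ i<t = subst₂ _~_ (sym (g≡f i (<⇒≤ i<t))) (sym (g≡f (suc i) i<t)) (step walk i i<t)
    ... | inj₂ refl = subst (_~ g (suc i)) (sym (g≡f i ≤-refl)) last-step
    noBack′ : ∀ i → 2 + i ≤ suc t → g (2 + i) ≢ g i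
    noBack′ i 2+i≤1+t with m≤n⇒m<n∨m≡n 2+i≤1+t
    ... | inj₁ 2+i≤t = subst₂ _≢_ (sym (g≡f (2 + i) (≤-pred 2+i≤t)))
                                  (sym (g≡f i (≤-trans (m≤n+m i 2) (≤-pred 2+i≤t))))
                                  (noBack walk i (≤-pred 2+i≤t))
    ... | inj₂ refl  = subst (g (2 + i) ≢_) (sym (g≡f i (n≤1+n i))) (last-noBack i refl)

  walk⇒node : ∀ {h t f} → NonBacktracking h t f → IsNode m b d h (walkNode f t)
  walk⇒node {t = zero}      walk = start walk
  walk⇒node {t = suc t} {f} walk =
    step walk t ≤-refl , noBack-last t (noBack walk) , walk⇒node (shorten (n≤1+n t) walk)
    where
    noBack-last : ∀ t → (∀ i → 2 + i ≤ suc t → f (2 + i) ≢ f i) → NoBack (f (suc t)) (walkNodeTail f t)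
    noBack-last zero    _       = tt
    noBack-last (suc t) noBack′ = noBack′ t ≤-refl

  node⇒walk : ∀ {h} x rest → IsNode m b d h (x ∷ rest) → NonBacktracking h (length rest) (ancestor (x ∷ rest))
  node⇒walk x [] x≡h = record { start = x≡h ; step = λ _ () ; noBack = λ _ () }
  node⇒walk x (y ∷ rest) (y~x , x-noBack , y-node) =
    extend (node⇒walk y rest y-node) (λ i i≤len → ancestor-∷ x (y ∷ rest) (s≤s i≤len))
      (subst₂ _~_ (sym (ancestor-last y rest)) (sym (ancestor-last x (y ∷ rest))) y~x)
      (noBack-last rest x-noBack)
    where
    noBack-last : ∀ rest → NoBack x rest → ∀ t' → length rest ≡ suc t' →
                  ancestor (x ∷ y ∷ rest) (suc (length rest)) ≢ ancestor (y ∷ rest) t'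
    noBack-last (z ∷ rest') x≢z t' refl x≡y′ = x≢z (begin
      x                                                     ≡⟨ ancestor-last x (y ∷ z ∷ rest') ⟨
      ancestor (x ∷ y ∷ z ∷ rest') (length (y ∷ z ∷ rest')) ≡⟨ x≡y′ ⟩
      ancestor (y ∷ z ∷ rest') t'                           ≡⟨ ancestor-∷ y (z ∷ rest') ≤-refl ⟩
      ancestor (z ∷ rest') t'                               ≡⟨ ancestor-last z rest' ⟩
      z                                                     ∎)
      where open ≡-Reasoning

  reverse : ∀ {h x s q} → NonBacktracking h s q → q s ≡ x → NonBacktracking x s (λ j → q (s ∸ j))
  reverse {s = s} {q} walk end = record
    { start  = end
    ; step   = λ j j<s → subst (_~ q (s ∸ suc j)) (cong q (sym (s∸j≡1+s∸[1+j] j<s)))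
                           (~-sym (step walk (s ∸ suc j) (∸-monoʳ-< (s≤s z≤n) j<s)))
    ; noBack = λ j 2+j≤s back → noBack walk (s ∸ (2 + j)) (subst (_≤ s) (s∸j≡2+s∸[2+j] 2+j≤s) (m∸n≤m s j))
                                  (trans (cong q (sym (s∸j≡2+s∸[2+j] 2+j≤s))) (sym back))
    }
    where
    s∸j≡1+s∸[1+j] : ∀ {j} → j < s → s ∸ j ≡ suc (s ∸ suc j)
    s∸j≡1+s∸[1+j] = +-∸-assoc 1
    s∸j≡2+s∸[2+j] : ∀ {j} → 2 + j ≤ s → s ∸ j ≡ 2 + (s ∸ (2 + j))
    s∸j≡2+s∸[2+j] 2+j≤s = trans (s∸j≡1+s∸[1+j] (≤-trans (n≤1+n _) 2+j≤s)) (cong suc (s∸j≡1+s∸[1+j] 2+j≤s))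

  module Concat {h x t s p r} (p-walk : NonBacktracking h t p) (r-walk : NonBacktracking x s r) where

    concat : ℕ → ℕ
    concat i with i ≤? t
    ... | yes _ = p i
    ... | no  _ = r (i ∸ t)

    concat-≤ : ∀ {i} → i ≤ t → concat i ≡ p i
    concat-≤ {i} i≤t with i ≤? t
    ... | yes _   = refl
    ... | no  i≰t = ⊥-elim (i≰t i≤t)

    concat-+ : p t ≡ r 0 → ∀ j → concat (t + j) ≡ r j
    concat-+ meet zero    = trans (concat-≤ (≤-reflexive (+-identityʳ t))) (trans (cong p (+-identityʳ t)) meet)
    concat-+ meet (suc j) with t + suc j ≤? t
    ... | yes t+1+j≤t = ⊥-elim (m+1+n≰m t t+1+j≤t)
    ... | no  _       = cong r (m+n∸m≡n t (suc j))

    private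
      below-or-above : ∀ i → i < t ⊎ ∃ λ j → i ≡ t + j
      below-or-above i with i <? t
      ... | yes i<t = inj₁ i<t
      ... | no  i≮t = inj₂ (i ∸ t , sym (m+[n∸m]≡n (≮⇒≥ i≮t)))

    concat-walk : p t ≡ r 0 → (∀ t' → t ≡ suc t' → 1 ≤ s → r 1 ≢ p t') → NonBacktracking h (t + s) concat
    concat-walk meet turn = record
      { start  = trans (concat-≤ z≤n) (start p-walk)
      ; step   = step′
      ; noBack = noBack′
      }
      where
      step′ : ∀ i → i < t + s → concat i ~ concat (suc i)
      step′ i i<t+s with below-or-above i
      ... | inj₁ i<t = subst₂ _~_ (sym (concat-≤ (<⇒≤ i<t))) (sym (concat-≤ i<t)) (step p-walk i i<t)
      ... | inj₂ (j , refl) =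
        subst₂ _~_ (sym (concat-+ meet j)) (sym (trans (cong concat (sym (+-suc t j))) (concat-+ meet (suc j))))
          (step r-walk j (+-cancelˡ-< t j s i<t+s))
      noBack′ : ∀ i → 2 + i ≤ t + s → concat (2 + i) ≢ concat i
      noBack′ i 2+i≤t+s with below-or-above i
      ... | inj₂ (j , refl) =
        subst₂ _≢_ (sym (trans (cong concat (sym shift)) (concat-+ meet (2 + j)))) (sym (concat-+ meet j))
          (noBack r-walk j (+-cancelˡ-≤ t (2 + j) s (subst (_≤ t + s) (sym shift) 2+i≤t+s)))
        where
        shift : t + (2 + j) ≡ 2 + (t + j)
        shift = trans (+-suc t (suc j)) (cong suc (+-suc t j))
      ... | inj₁ i<t with m≤n⇒m<n∨m≡n i<t
      ...   | inj₁ 2+i≤t = subst₂ _≢_ (sym (concat-≤ 2+i≤t)) (sym (concat-≤ (<⇒≤ i<t))) (noBack p-walk i 2+i≤t)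
      ...   | inj₂ 1+i≡t = subst₂ _≢_ (sym (trans (cong concat 2+i≡t+1) (concat-+ meet 1))) (sym (concat-≤ (<⇒≤ i<t)))
                             (turn i (sym 1+i≡t) (+-cancelˡ-≤ t 1 s (subst (_≤ t + s) 2+i≡t+1 2+i≤t+s)))
        where
        2+i≡t+1 : 2 + i ≡ t + 1
        2+i≡t+1 = trans (cong suc 1+i≡t) (+-comm 1 t)

  CycleOfLengthAtMost : ℕ → Set
  CycleOfLengthAtMost n = ∃ λ c → c ≤ n × HasCycleOfLength m b d c

  CycleOfLengthAtMost-mono : ∀ {n n'} → n ≤ n' → CycleOfLengthAtMost n → CycleOfLengthAtMost n'
  CycleOfLengthAtMost-mono n≤n' (c , c≤n , cycle) = c , ≤-trans c≤n n≤n' , cycle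

  Revisits : (ℕ → ℕ) → ℕ → Set
  Revisits v j = ∃ λ i → i < j × v i ≡ v j

  firstRevisit⇒cycle : ∀ {x k v i j} → NonBacktracking x k v → IsLeast (Revisits v) j → j ≤ k →
                       i < j → v i ≡ v j → IsCycle m b d (j ∸ i) (λ z → v (i + z))
  firstRevisit⇒cycle {k = k} {v} {i} {j} walk (_ , first) j≤k i<j vi≡vj =
    length≥3 (j ∸ i) i+c≡j , closed , step′ , distinct
    where
    i+c≡j : i + (j ∸ i) ≡ j
    i+c≡j = m+[n∸m]≡n (<⇒≤ i<j)
    -- Loops are excluded by irreflexivity and cycles of length 2 by non-backtracking.
    length≥3 : ∀ c → i + c ≡ j → 3 ≤ c
    length≥3 0 i+0≡j = ⊥-elim (<-irrefl (trans (sym (+-identityʳ i)) i+0≡j) i<j)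
    length≥3 1 i+1≡j = ⊥-elim (Adj-irrefl (subst (v i ~_) (trans (cong v (trans (+-comm 1 i) i+1≡j)) (sym vi≡vj))
                                                      (step walk i (<-≤-trans i<j j≤k))))
    length≥3 2 i+2≡j = ⊥-elim (noBack walk i (subst (_≤ k) (sym 2+i≡j) j≤k) (trans (cong v 2+i≡j) (sym vi≡vj)))
      where
      2+i≡j : 2 + i ≡ j
      2+i≡j = trans (+-comm 2 i) i+2≡j
    length≥3 (suc (suc (suc _))) _ = s≤s (s≤s (s≤s z≤n))
    closed : v (i + (j ∸ i)) ≡ v (i + 0)
    closed = trans (cong v i+c≡j) (trans (sym vi≡vj) (cong v (sym (+-identityʳ i))))
    i+z<j : ∀ {z} → z < j ∸ i → i + z < j
    i+z<j z<c = subst (_ <_) i+c≡j (+-monoʳ-< i z<c)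
    step′ : ∀ z → z < j ∸ i → v (i + z) ~ v (i + suc z)
    step′ z z<c = subst (v (i + z) ~_) (cong v (sym (+-suc i z))) (step walk (i + z) (<-≤-trans (i+z<j z<c) j≤k))
    distinct : ∀ z₁ z₂ → z₁ < z₂ → z₂ < j ∸ i → v (i + z₁) ≢ v (i + z₂)
    distinct z₁ z₂ z₁<z₂ z₂<c revisit = <⇒≱ (i+z<j z₂<c) (first (i + z₂) (i + z₁ , +-monoʳ-< i z₁<z₂ , revisit))

  closedWalk⇒cycle : ∀ {x k v} → NonBacktracking x k v → 1 ≤ k → v k ≡ x → CycleOfLengthAtMost k
  closedWalk⇒cycle {x} {k} {v} walk 1≤k closed = cycleAtFirstRevisit (proj₂ (least-exists revisits? revisit-at-k))
    where
    revisits? : ∀ j → Dec (Revisits v j)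
    revisits? j = anyUpTo? (λ i → v i ≟ v j) j
    revisit-at-k : Revisits v k
    revisit-at-k = 0 , 1≤k , trans (start walk) (sym closed)
    cycleAtFirstRevisit : ∀ {j} → IsLeast (Revisits v) j → CycleOfLengthAtMost k
    cycleAtFirstRevisit {j} least@((i , i<j , vi≡vj) , first) =
      j ∸ i , ≤-trans (m∸n≤m j i) j≤k , _ , firstRevisit⇒cycle walk least j≤k i<j vi≡vj
      where
      j≤k : j ≤ k
      j≤k = first k revisit-at-k

  cycle⇒walk : ∀ {k w} → IsCycle m b d k w → NonBacktracking (w 0) k w
  cycle⇒walk {k} {w} (3≤k , closed , step′ , distinct) = record
    { start  = refl
    ; step   = step′
    ; noBack = noBack′
    }
    where
    noBack′ : ∀ i → 2 + i ≤ k → w (2 + i) ≢ w i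
    noBack′ i 2+i≤k with m≤n⇒m<n∨m≡n 2+i≤k
    ... | inj₁ 2+i<k = distinct i (2 + i) (m<n+m i (s≤s z≤n)) 2+i<k ∘ sym
    ... | inj₂ refl  = distinct 0 i (≤-pred (≤-pred 3≤k)) (m<n+m i (s≤s z≤n)) ∘ trans (sym closed)

  join⇒cycle : ∀ {h t s p q} → NonBacktracking h t p → NonBacktracking h s q → 1 ≤ t → p t ≡ q s →
               (∀ t' s' → t ≡ suc t' → s ≡ suc s' → p t' ≢ q s') → CycleOfLengthAtMost (t + s)
  join⇒cycle {h} {t} {s} {p} {q} p-walk q-walk 1≤t meet distinctParents =
    closedWalk⇒cycle (concat-walk meet turn) (≤-trans 1≤t (m≤m+n t s)) closed
    where
    open Concat p-walk (reverse q-walk refl)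
    turn : ∀ t' → t ≡ suc t' → 1 ≤ s → q (s ∸ 1) ≢ p t'
    turn t' t≡1+t' (s≤s {n = s'} z≤n) = distinctParents t' s' t≡1+t' refl ∘ sym
    closed : concat (t + s) ≡ h
    closed = trans (concat-+ meet s) (trans (cong q (n∸n≡0 s)) (start q-walk))

  module Tree (h : ℕ) (h∈V : InV m h) where

    Node : List ℕ → Set
    Node = IsNode m b d h

    label∈V : ∀ a rest → Node (a ∷ rest) → InV m a
    label∈V a []      a≡h       = subst (InV m) (sym a≡h) h∈V
    label∈V a (_ ∷ _) (y~a , _) = proj₁ (proj₂ y~a)

    private
      Child : List ℕ → ℕ → Set
      Child []         x = ⊥
      Child (y ∷ rest) x = y ~ x × NoBack x rest

      child? : ∀ p x → Dec (Child p x)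
      child? []             x = no λ ()
      child? (y ∷ [])       x = y ~? x ×-dec yes tt
      child? (y ∷ z ∷ rest) x = y ~? x ×-dec ¬? (x ≟ z)

    node? : ∀ t {P : List ℕ → Set} → (∀ p → Dec (P p)) → Dec (∃ λ p → Node p × depth p ≡ t × P p)
    node? zero {P} P? with P? (h ∷ [])
    ... | yes Ph = yes (h ∷ [] , refl , refl , Ph)
    ... | no ¬Ph = no λ { (_ ∷ [] , refl , _ , Ph) → ¬Ph Ph ; (_ ∷ _ ∷ _ , _ , () , _) }
    node? (suc t) {P} P? = map′ parent⇒node node⇒parent (node? t parentOf?)
      where
      ParentOf : List ℕ → Set
      ParentOf p = ∃ λ x → x < suc (2 * m) × Child p x × P (x ∷ p)
      parentOf? : ∀ p → Dec (ParentOf p)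
      parentOf? p = anyUpTo? (λ x → child? p x ×-dec P? (x ∷ p)) (suc (2 * m))
      parent⇒node : (∃ λ p → Node p × depth p ≡ t × ParentOf p) → ∃ λ p → Node p × depth p ≡ suc t × P p
      parent⇒node (y ∷ rest , y-node , refl , x , _ , (y~x , x-noBack) , Px) =
        x ∷ y ∷ rest , (y~x , x-noBack , y-node) , refl , Px
      node⇒parent : (∃ λ p → Node p × depth p ≡ suc t × P p) → ∃ λ p → Node p × depth p ≡ t × ParentOf p
      node⇒parent (x ∷ y ∷ rest , (y~x , x-noBack , y-node) , refl , Px) =
        y ∷ rest , y-node , refl , x , s≤s (proj₂ (label∈V x (y ∷ rest) (y~x , x-noBack , y-node))) , (y~x , x-noBack) , Px

    HasLabel : ℕ → List ℕ → Set
    HasLabel a p = ∃ λ rest → p ≡ a ∷ rest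

    hasLabel? : ∀ a p → Dec (HasLabel a p)
    hasLabel? a []         = no λ { (_ , ()) }
    hasLabel? a (x ∷ rest) = map′ (λ x≡a → rest , cong (_∷ rest) x≡a) (List.∷-injectiveˡ ∘ proj₂) (x ≟ a)

    nodeAt? : ∀ s a → Dec (∃ (NodeAt m b d h s a))
    nodeAt? s a = node? s (hasLabel? a)

    repeated? : ∀ t a → Dec (Repeated m b d h t a)
    repeated? t a = map′
      (λ (p , p-node , p-depth , p-label , t' , t'<1+t , q , q-node , q-depth , q-label , p≢q) →
         p , q , t' , (p-node , p-depth , p-label) , (q-node , q-depth , q-label) , ≤-pred t'<1+t , p≢q)
      (λ (p , q , t' , (p-node , p-depth , p-label) , (q-node , q-depth , q-label) , t'≤t , p≢q) →
         p , p-node , p-depth , p-label , t' , s≤s t'≤t , q , q-node , q-depth , q-label , p≢q)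
      (node? t λ p → hasLabel? a p ×-dec
         anyUpTo? (λ t' → node? t' λ q → hasLabel? a q ×-dec ¬? (List.≡-dec _≟_ p q)) (suc t))

    someRepeated? : ∀ t → Dec (∃ (Repeated m b d h t))
    someRepeated? t = ∃-bounded? (repeated? t) (2 * m) λ { a (_ , _ , _ , (p-node , _ , rest , refl) , _) → proj₂ (label∈V a rest p-node) }

    cycle⇒repeated : ∀ {k w} → IsCycle m b d k w → w 0 ≡ h →
                     Repeated m b d h ⌈ k /2⌉ (w ⌈ k /2⌉) × ∃ (NodeAt m b d h ⌊ k /2⌋ (w ⌈ k /2⌉))
    cycle⇒repeated {k} {w} cycle@(s≤s (s≤s (s≤s _)) , closed , _ , distinct) w0≡h =
      (forwardNode , backwardNode , ⌊ k /2⌋ , forwardAt , backwardAt , ⌊n/2⌋≤⌈n/2⌉ k , forward≢backward) ,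
      backwardNode , backwardAt
      where
      walk : NonBacktracking h k w
      walk = subst (λ x → NonBacktracking x k w) w0≡h (cycle⇒walk cycle)
      w̄ : ℕ → ℕ
      w̄ j = w (k ∸ j)
      forward : NonBacktracking h ⌈ k /2⌉ w
      forward = shorten (⌈n/2⌉≤n k) walk
      backward : NonBacktracking h ⌊ k /2⌋ w̄
      backward = shorten (⌊n/2⌋≤n k) (reverse walk (trans closed w0≡h))
      k∸⌊k/2⌋≡⌈k/2⌉ : k ∸ ⌊ k /2⌋ ≡ ⌈ k /2⌉
      k∸⌊k/2⌋≡⌈k/2⌉ = trans (cong (_∸ ⌊ k /2⌋) (sym (⌊n/2⌋+⌈n/2⌉≡n k))) (m+n∸m≡n ⌊ k /2⌋ ⌈ k /2⌉)
      forwardNode backwardNode : List ℕ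
      forwardNode  = walkNode w ⌈ k /2⌉
      backwardNode = walkNode w̄ ⌊ k /2⌋
      forwardAt : NodeAt m b d h ⌈ k /2⌉ (w ⌈ k /2⌉) forwardNode
      forwardAt = walk⇒node forward , walkNode-depth w ⌈ k /2⌉ , _ , refl
      backwardAt : NodeAt m b d h ⌊ k /2⌋ (w ⌈ k /2⌉) backwardNode
      backwardAt = walk⇒node backward , walkNode-depth w̄ ⌊ k /2⌋ , _ , cong (λ i → w i ∷ walkNodeTail w̄ ⌊ k /2⌋) k∸⌊k/2⌋≡⌈k/2⌉
      -- Equal nodes would make the second vertices w 1 and w (k ∸ 1) of the two walks coincide.
      forward≢backward : forwardNode ≢ backwardNode
      forward≢backward eq = distinct 1 (k ∸ 1) (s≤s (s≤s z≤n)) ≤-refl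
        (walkNode-injective ⌊ k /2⌋ (subst (λ n → walkNode w n ≡ backwardNode) ⌈k/2⌉≡⌊k/2⌋ eq) 1 (s≤s z≤n))
        where
        ⌈k/2⌉≡⌊k/2⌋ : ⌈ k /2⌉ ≡ ⌊ k /2⌋
        ⌈k/2⌉≡⌊k/2⌋ = trans (sym (walkNode-depth w ⌈ k /2⌉)) (trans (cong depth eq) (walkNode-depth w̄ ⌊ k /2⌋))

    Candidate : ℕ → ℕ → Set
    Candidate t ℓ = ∃ λ a → ∃ λ s → Repeated m b d h t a × IsSa m b d h a s × ℓ ≡ s + t

    candidate? : ∀ t ℓ → Dec (Candidate t ℓ)
    candidate? t ℓ =
      ∃-bounded? (λ a → ∃-bounded? (λ s → repeated? t a ×-dec isLeast? (λ s → nodeAt? s a) s ×-dec ℓ ≟ s + t)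
                                   ℓ λ { s (_ , _ , refl) → m≤m+n s t })
                 (2 * m) λ { a (_ , (_ , _ , _ , (p-node , _ , rest , refl) , _) , _) → proj₂ (label∈V a rest p-node) }

    repeated⇒L : ∀ {t a} → Repeated m b d h t a → ∃ (IsL m b d h)
    repeated⇒L rep with least-exists someRepeated? (_ , rep)
    ... | t , th@((a , rep′@(p , _ , _ , p-at , _)) , _) with least-exists (λ s → nodeAt? s a) (p , p-at)
    ...   | s , sa with least-exists (candidate? t) (a , s , rep′ , sa , refl)
    ...     | ℓ , L = ℓ , t , th , L

    IsSa≤Repeated : ∀ {t a s} → Repeated m b d h t a → IsSa m b d h a s → s ≤ t
    IsSa≤Repeated (_ , q , t' , _ , q-at , t'≤t , _) (_ , s-least) = ≤-trans (s-least t' (q , q-at)) t'≤t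

    L≤cycle : ∀ {k w ℓ} → IsCycle m b d k w → w 0 ≡ h → IsL m b d h ℓ → ℓ ≤ k
    L≤cycle {k} {w} cycle w0≡h (t , (_ , t-least) , (a , s , rep , sa , refl) , ℓ-least)
      with cycle⇒repeated cycle w0≡h
    ... | rep-half , q , q-at = subst (s + t ≤_) (⌊n/2⌋+⌈n/2⌉≡n k) (bound (m≤n⇒m<n∨m≡n t≤⌈k/2⌉))
      where
      t≤⌈k/2⌉ : t ≤ ⌈ k /2⌉
      t≤⌈k/2⌉ = t-least ⌈ k /2⌉ (_ , rep-half)
      bound : t < ⌈ k /2⌉ ⊎ t ≡ ⌈ k /2⌉ → s + t ≤ ⌊ k /2⌋ + ⌈ k /2⌉
      bound (inj₁ t<⌈k/2⌉) =
        +-mono-≤ (≤-trans (IsSa≤Repeated rep sa) (≤-pred (≤-trans t<⌈k/2⌉ (⌊n/2⌋-mono (n≤1+n (suc k)))))) (<⇒≤ t<⌈k/2⌉)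
      bound (inj₂ refl) with least-exists (λ s → nodeAt? s (w t)) (q , q-at)
      ... | s′ , sa′@(_ , s′-least) =
        ≤-trans (ℓ-least (s′ + t) (w t , s′ , rep-half , sa′ , refl)) (+-monoˡ-≤ t (s′-least ⌊ k /2⌋ (q , q-at)))

    -- Were the parents of the two nodes equally labelled, the repetition would already occur at depth t ∸ 1.
    distinctNodes⇒cycle : ∀ {t s a p q} → NodeAt m b d h t a p → NodeAt m b d h s a q → s ≤ t → p ≢ q →
                          (∀ t' → ∃ (Repeated m b d h t') → t ≤ t') → CycleOfLengthAtMost (t + s)
    distinctNodes⇒cycle (_ , refl , [] , refl) (_ , refl , [] , refl) _ p≢q _ = ⊥-elim (p≢q refl)
    distinctNodes⇒cycle {a = a} (p-node , refl , y ∷ P , refl) (q-node , refl , [] , refl) _ _ _ =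
      join⇒cycle (node⇒walk a (y ∷ P) p-node) (node⇒walk a [] q-node) (s≤s z≤n)
        (ancestor-last a (y ∷ P)) λ _ _ _ ()
    distinctNodes⇒cycle {a = a} (p-node , refl , y ∷ P , refl) (q-node , refl , z ∷ Q , refl) s≤t p≢q t-least =
      join⇒cycle (node⇒walk a (y ∷ P) p-node) (node⇒walk a (z ∷ Q) q-node) (s≤s z≤n)
        (trans (ancestor-last a (y ∷ P)) (sym (ancestor-last a (z ∷ Q)))) distinctParents
      where
      distinctParents : ∀ t' s' → suc (length P) ≡ suc t' → suc (length Q) ≡ suc s' →
                        ancestor (a ∷ y ∷ P) t' ≢ ancestor (a ∷ z ∷ Q) s'
      distinctParents _ _ refl refl y≡z′ with List.≡-dec _≟_ (y ∷ P) (z ∷ Q)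
      ... | yes parents≡ = p≢q (cong (a ∷_) parents≡)
      ... | no  parents≢ = 1+n≰n (t-least (length P) (y , y ∷ P , z ∷ Q , length Q ,
              (proj₂ (proj₂ p-node) , refl , P , refl) , (proj₂ (proj₂ q-node) , refl , Q , cong (_∷ Q) (sym y≡z)) ,
              ≤-pred s≤t , parents≢))
        where
        y≡z : y ≡ z
        y≡z = begin
          y                                ≡⟨ ancestor-last y P ⟨
          ancestor (y ∷ P) (length P)      ≡⟨ ancestor-∷ a (y ∷ P) ≤-refl ⟨
          ancestor (a ∷ y ∷ P) (length P)  ≡⟨ y≡z′ ⟩
          ancestor (a ∷ z ∷ Q) (length Q)  ≡⟨ ancestor-∷ a (z ∷ Q) ≤-refl ⟩
          ancestor (z ∷ Q) (length Q)      ≡⟨ ancestor-last z Q ⟩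
          z                                ∎
          where open ≡-Reasoning

    L⇒cycle : ∀ {ℓ} → IsL m b d h ℓ → CycleOfLengthAtMost ℓ
    L⇒cycle (t , (_ , t-least) , (a , s , (p , q , t' , p-at , q-at , t'≤t , p≢q) , ((r , r-at) , _) , refl) , _)
      with s <? t
    ... | yes s<t = CycleOfLengthAtMost-mono (≤-reflexive (+-comm t s))
                      (distinctNodes⇒cycle p-at r-at (<⇒≤ s<t) p≢r t-least)
      where
      p≢r : p ≢ r
      p≢r p≡r = <-irrefl (trans (sym (proj₁ (proj₂ r-at))) (trans (cong depth (sym p≡r)) (proj₁ (proj₂ p-at)))) s<t
    ... | no  s≮t = CycleOfLengthAtMost-mono (subst (t + t' ≤_) (+-comm t s) (+-monoʳ-≤ t (≤-trans t'≤t (≮⇒≥ s≮t))))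
                      (distinctNodes⇒cycle p-at q-at t'≤t p≢q t-least)

module Chords (m' b' : ℕ) (d : ℕ → ℕ) where

  m b N : ℕ
  m = suc m'
  b = suc b'
  N = 2 * m

  open Congruence N public

  D : ℕ → ℕ
  D x = d (chordIndex b x)

  chord-InR : ∀ x → InR (chord m b d x)
  chord-InR x = rep-InR (x + D x)

  chord≈ : ∀ {x} → 1 ≤ x → chord m b d x ≈ x + D x
  chord≈ {x} 1≤x = rep≈ (≤-trans 1≤x (m≤m+n x (D x)))

  ≈⇒%2≡ : ∀ {x y} → x ≈ y → x % 2 ≡ y % 2
  ≈⇒%2≡ {x} {y} (mod-≡ e) =
    trans (sym (m∣n⇒o%n%m≡o%m 2 N x (m∣m*n m))) (trans (cong (_% 2) e) (m∣n⇒o%n%m≡o%m 2 N y (m∣m*n m)))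

  module _ (d-odd : ∀ j → 1 ≤ j → j ≤ b → OddN (d j)) where

    chordIndex-InRange : ∀ x → 1 ≤ chordIndex b x × chordIndex b x ≤ b
    chordIndex-InRange x = m≤n+m 1 _ , subst (_≤ b) (+-comm 1 _) (m%n<n (x / 2) b)

    chord-even : ∀ {x} → 1 ≤ x → OddN x → chord m b d x % 2 ≡ 0
    chord-even {x} 1≤x x-odd = begin
      chord m b d x % 2            ≡⟨ ≈⇒%2≡ (chord≈ 1≤x) ⟩
      (x + D x) % 2                ≡⟨ %-distribˡ-+ x (D x) 2 ⟩
      (x % 2 + D x % 2) % 2        ≡⟨ cong₂ (λ u v → (u + v) % 2) x-odd (uncurry (d-odd (chordIndex b x)) (chordIndex-InRange x)) ⟩
      0                            ∎
      where open ≡-Reasoning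

    Adj-irrefl : ∀ {x} → ¬ Adj m b d x x
    Adj-irrefl (_ , _ , inj₁ (inj₁ x≡1+x))               = 1+n≢n (sym x≡1+x)
    Adj-irrefl (_ , _ , inj₁ (inj₂ (refl , N≡1)))        = m+1+n≢0 m' (suc-injective N≡1)
    Adj-irrefl (_ , _ , inj₂ (inj₁ (inj₁ x≡1+x)))        = 1+n≢n (sym x≡1+x)
    Adj-irrefl (_ , _ , inj₂ (inj₁ (inj₂ (refl , N≡1)))) = m+1+n≢0 m' (suc-injective N≡1)
    Adj-irrefl ((1≤x , _) , _ , inj₂ (inj₂ (inj₁ (x-odd , x≡chord)))) =
      0≢1+n (trans (sym (chord-even 1≤x x-odd)) (trans (cong (_% 2) (sym x≡chord)) x-odd))
    Adj-irrefl ((1≤x , _) , _ , inj₂ (inj₂ (inj₂ (x-odd , x≡chord)))) =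
      0≢1+n (trans (sym (chord-even 1≤x x-odd)) (trans (cong (_% 2) (sym x≡chord)) x-odd))

  hamiltonianCycle : 3 ≤ N → ∀ {h} → InR h → ∃ λ w → IsCycle m b d N w × w 0 ≡ h
  hamiltonianCycle 3≤N {h} h∈ = w , (3≤N , closed , step , distinct) , w0≡h
    where
    w : ℕ → ℕ
    w i = rep (h + i)
    w≈ : ∀ i → w i ≈ h + i
    w≈ i = rep≈ (≤-trans (proj₁ h∈) (m≤m+n h i))
    w0≡h : w 0 ≡ h
    w0≡h = ≈⇒≡ (rep-InR (h + 0)) h∈ (≈-trans (w≈ 0) (≡⇒≈ (+-identityʳ h)))
    closed : w N ≡ w 0
    closed = ≈⇒≡ (rep-InR (h + N)) (rep-InR (h + 0)) (begin
      w N      ≈⟨ w≈ N ⟩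
      h + N    ≈⟨ +N≈ h ⟩
      h        ≡⟨ +-identityʳ h ⟨
      h + 0    ≈⟨ w≈ 0 ⟨
      w 0      ∎)
      where open ≈-Reasoning
    step : ∀ i → i < N → Adj m b d (w i) (w (suc i))
    step i _ = rep-InR (h + i) , rep-InR (h + suc i) , inj₁ (≈⇒cyclicStep (rep-InR (h + i)) (rep-InR (h + suc i)) (begin
      w i + 1          ≈⟨ +-congʳ 1 (w≈ i) ⟩
      h + i + 1        ≡⟨ trans (+-assoc h i 1) (cong (h +_) (+-comm i 1)) ⟩
      h + suc i        ≈⟨ w≈ (suc i) ⟨
      w (suc i)        ∎))
      where open ≈-Reasoning
    distinct : ∀ i j → i < j → j < N → w i ≢ w j
    distinct i j i<j j<N wi≡wj = <-irrefl (<N⇒≈⇒≡ (<-trans i<j j<N) j<N (+-cancelʳ h (begin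
      i + h    ≡⟨ +-comm i h ⟩
      h + i    ≈⟨ w≈ i ⟨
      w i      ≡⟨ wi≡wj ⟩
      w j      ≈⟨ w≈ j ⟩
      h + j    ≡⟨ +-comm h j ⟩
      j + h    ∎))) i<j
      where open ≈-Reasoning

  period : ℕ
  period = b * 2

  chordIndex-periodic : ∀ {x y} → x % period ≡ y % period → chordIndex b x ≡ chordIndex b y
  chordIndex-periodic {x} {y} e =
    cong (_+ 1) (trans (sym (m%[n*o]/o≡m/o%n x b 2)) (trans (cong (_/ 2) e) (m%[n*o]/o≡m/o%n y b 2)))

  parity-periodic : ∀ {x y} → x % period ≡ y % period → x % 2 ≡ y % 2
  parity-periodic {x} {y} e =
    trans (sym (m∣n⇒o%n%m≡o%m 2 period x (n∣m*n b))) (trans (cong (_% 2) e) (m∣n⇒o%n%m≡o%m 2 period y (n∣m*n b)))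

  module Rotation (b∣m : b ∣ m) where

    period∣N : period ∣ N
    period∣N = subst (period ∣_) (*-comm m 2) (*-monoˡ-∣ 2 b∣m)

    ≈⇒%period≡ : ∀ {x y} → x ≈ y → x % period ≡ y % period
    ≈⇒%period≡ {x} {y} (mod-≡ e) =
      trans (sym (m∣n⇒o%n%m≡o%m period N x period∣N)) (trans (cong (_% period) e) (m∣n⇒o%n%m≡o%m period N y period∣N))

    module RotateBy (s : ℕ) (s≤N : s ≤ N) (period∣s : period ∣ s) where

      rotate : ℕ → ℕ
      rotate x = rep (x + (N ∸ s))

      rotate-InR : ∀ x → InR (rotate x)
      rotate-InR x = rep-InR (x + (N ∸ s))

      rotate+s≈ : ∀ {x} → 1 ≤ x → rotate x + s ≈ x
      rotate+s≈ {x} 1≤x = begin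
        rotate x + s          ≈⟨ +-congʳ s (rep≈ (≤-trans 1≤x (m≤m+n x (N ∸ s)))) ⟩
        x + (N ∸ s) + s       ≡⟨ trans (+-assoc x (N ∸ s) s) (cong (x +_) (m∸n+n≡m s≤N)) ⟩
        x + N                 ≈⟨ +N≈ x ⟩
        x                     ∎
        where open ≈-Reasoning

      rotate-%period : ∀ {x} → 1 ≤ x → rotate x % period ≡ x % period
      rotate-%period {x} 1≤x = trans (sym (%-remove-+ʳ (rotate x) period∣s)) (≈⇒%period≡ (rotate+s≈ 1≤x))

      rotate-injective : ∀ {x y} → InR x → InR y → rotate x ≡ rotate y → x ≡ y
      rotate-injective x∈ y∈ e =
        ≈⇒≡ x∈ y∈ (≈-trans (≈-sym (rotate+s≈ (proj₁ x∈))) (≈-trans (≡⇒≈ (cong (_+ s) e)) (rotate+s≈ (proj₁ y∈))))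

      rotate-CycE : ∀ {x y} → InR x → InR y → CycE m x y → CycE m (rotate x) (rotate y)
      rotate-CycE {x} {y} x∈ y∈ x→y = ≈⇒cyclicStep (rotate-InR x) (rotate-InR y) (+-cancelʳ s (begin
        rotate x + 1 + s      ≡⟨ xy∙z≈xz∙y (rotate x) 1 s ⟩
        rotate x + s + 1      ≈⟨ +-congʳ 1 (rotate+s≈ (proj₁ x∈)) ⟩
        x + 1                 ≈⟨ cyclicStep⇒≈ x→y ⟩
        y                     ≈⟨ rotate+s≈ (proj₁ y∈) ⟨
        rotate y + s          ∎))
        where open ≈-Reasoning

      rotate-ChordE : ∀ {x y} → InR x → InR y → ChordE m b d x y → ChordE m b d (rotate x) (rotate y)
      rotate-ChordE {x} {y} x∈ y∈ (x-odd , refl) =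
        trans (parity-periodic {rotate x} {x} (rotate-%period (proj₁ x∈))) x-odd ,
        ≈⇒≡ (rotate-InR y) (chord-InR (rotate x)) (+-cancelʳ s (begin
          rotate y + s                  ≈⟨ rotate+s≈ (proj₁ y∈) ⟩
          y                             ≈⟨ chord≈ (proj₁ x∈) ⟩
          x + D x                       ≈⟨ +-congʳ (D x) (rotate+s≈ (proj₁ x∈)) ⟨
          rotate x + s + D x            ≡⟨ xy∙z≈xz∙y (rotate x) s (D x) ⟩
          rotate x + D x + s            ≡⟨ cong (λ j → rotate x + d j + s) (chordIndex-periodic {rotate x} {x} (rotate-%period (proj₁ x∈))) ⟨
          rotate x + D (rotate x) + s   ≈⟨ +-congʳ s (chord≈ (proj₁ (rotate-InR x))) ⟨
          chord m b d (rotate x) + s    ∎))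
        where open ≈-Reasoning

      rotate-Adj : ∀ {x y} → Adj m b d x y → Adj m b d (rotate x) (rotate y)
      rotate-Adj {x} {y} (x∈ , y∈ , edge) = rotate-InR x , rotate-InR y , rotate-edge edge
        where
        rotate-edge : CycE m x y ⊎ CycE m y x ⊎ ChordE m b d x y ⊎ ChordE m b d y x →
                      CycE m (rotate x) (rotate y) ⊎ CycE m (rotate y) (rotate x) ⊎
                      ChordE m b d (rotate x) (rotate y) ⊎ ChordE m b d (rotate y) (rotate x)
        rotate-edge (inj₁ e)               = inj₁ (rotate-CycE x∈ y∈ e)
        rotate-edge (inj₂ (inj₁ e))        = inj₂ (inj₁ (rotate-CycE y∈ x∈ e))
        rotate-edge (inj₂ (inj₂ (inj₁ e))) = inj₂ (inj₂ (inj₁ (rotate-ChordE x∈ y∈ e)))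
        rotate-edge (inj₂ (inj₂ (inj₂ e))) = inj₂ (inj₂ (inj₂ (rotate-ChordE y∈ x∈ e)))

    -- Choosing s = ⌊(w 0 ∸ 1) / period⌋ * period moves w 0 to (w 0 ∸ 1) % period + 1.
    cycle-rotate : ∀ {k w} → IsCycle m b d k w → ∃ λ w' → IsCycle m b d k w' × 1 ≤ w' 0 × w' 0 ≤ 2 * b
    cycle-rotate {k} {w} cycle@(3≤k , _ , step , _) =
      rotate ∘ w , IsCycle-map {m} {b} {d} rotate rotate-Adj rotate-injective cycle ,
      subst (1 ≤_) (sym rotate-w0) (m≤n+m 1 _) , subst (_≤ 2 * b) (sym rotate-w0) (subst (r + 1 ≤_) (*-comm b 2) r+1≤period)
      where
      w0∈ : InR (w 0)
      w0∈ = proj₁ (step 0 (≤-trans (s≤s z≤n) 3≤k))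
      u r s : ℕ
      u = w 0 ∸ 1
      r = u % period
      s = u / period * period
      open RotateBy s (≤-trans (m/n*n≤m u period) (≤-trans (m∸n≤m (w 0) 1) (proj₂ w0∈))) (n∣m*n (u / period))
      r+1≤period : r + 1 ≤ period
      r+1≤period = subst (_≤ period) (+-comm 1 r) (m%n<n u period)
      w0≡r+1+s : w 0 ≡ r + 1 + s
      w0≡r+1+s = begin
        w 0          ≡⟨ m∸n+n≡m (proj₁ w0∈) ⟨
        u + 1        ≡⟨ cong (_+ 1) (m≡m%n+[m/n]*n u period) ⟩
        r + s + 1    ≡⟨ xy∙z≈xz∙y r s 1 ⟩
        r + 1 + s    ∎
        where open ≡-Reasoning
      rotate-w0 : rotate (w 0) ≡ r + 1
      rotate-w0 = ≈⇒≡ (rotate-InR (w 0)) (m≤n+m 1 r , ≤-trans r+1≤period (∣⇒≤ period∣N))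
                    (+-cancelʳ s (≈-trans (rotate+s≈ (proj₁ w0∈)) (≡⇒≈ w0≡r+1+s)))

¬Cubic-1 : ∀ {b d} → ¬ Cubic 1 b d
¬Cubic-1 cubic with cubic 1 (s≤s z≤n , s≤s z≤n)
... | _ , _ , _ , u₁≢u₂ , u₁≢u₃ , u₂≢u₃ , (_ , u₁∈ , _) , (_ , u₂∈ , _) , (_ , u₃∈ , _) , _ =
  pigeonhole (oneOrTwo u₁∈) (oneOrTwo u₂∈) (oneOrTwo u₃∈) u₁≢u₂ u₁≢u₃ u₂≢u₃
  where
  oneOrTwo : ∀ {u} → InV 1 u → u ≡ 1 ⊎ u ≡ 2
  oneOrTwo (s≤s z≤n , s≤s z≤n)       = inj₁ refl
  oneOrTwo (s≤s z≤n , s≤s (s≤s z≤n)) = inj₂ refl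
  pigeonhole : ∀ {u₁ u₂ u₃ : ℕ} → u₁ ≡ 1 ⊎ u₁ ≡ 2 → u₂ ≡ 1 ⊎ u₂ ≡ 2 → u₃ ≡ 1 ⊎ u₃ ≡ 2 →
               u₁ ≢ u₂ → u₁ ≢ u₃ → u₂ ≢ u₃ → ⊥
  pigeonhole (inj₁ refl) (inj₁ refl) _           u₁≢u₂ _     _     = u₁≢u₂ refl
  pigeonhole (inj₂ refl) (inj₂ refl) _           u₁≢u₂ _     _     = u₁≢u₂ refl
  pigeonhole (inj₁ refl) (inj₂ refl) (inj₁ refl) _     u₁≢u₃ _     = u₁≢u₃ refl
  pigeonhole (inj₁ refl) (inj₂ refl) (inj₂ refl) _     _     u₂≢u₃ = u₂≢u₃ refl
  pigeonhole (inj₂ refl) (inj₁ refl) (inj₁ refl) _     _     u₂≢u₃ = u₂≢u₃ refl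
  pigeonhole (inj₂ refl) (inj₁ refl) (inj₂ refl) _     u₁≢u₃ _     = u₁≢u₃ refl

cubic⇒3≤2m : ∀ {m' b d} → Cubic (suc m') b d → 3 ≤ 2 * suc m'
cubic⇒3≤2m {zero} {b} {d} cubic = ⊥-elim (¬Cubic-1 {b} {d} cubic)
cubic⇒3≤2m {suc _}          _     = ≤-trans (n≤1+n 3) (*-monoʳ-≤ 2 (s≤s (s≤s z≤n)))

IsL-unique : ∀ {m b d h ℓ ℓ'} → IsL m b d h ℓ → IsL m b d h ℓ' → ℓ ≡ ℓ'
IsL-unique (_ , th , L) (_ , th' , L') with IsLeast-unique th th'
... | refl = IsLeast-unique L L'

module Girth (m' b' : ℕ) (d : ℕ → ℕ) (d-odd : ∀ j → 1 ≤ j → j ≤ suc b' → OddN (d j))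
             (b∣m : suc b' ∣ suc m') (3≤N : 3 ≤ 2 * suc m') where

  open Chords m' b' d
  open Rotation b∣m
  open Walks m b d (Adj-irrefl d-odd)

  -- Abstract, because unfolding the Hamiltonian cycle during unification is prohibitively slow.
  abstract
    L-exists : ∀ h → InR h → ∃ (IsL m b d h)
    L-exists h h∈ with hamiltonianCycle 3≤N h∈
    ... | w , cycle , w0≡h = repeated⇒L (proj₁ (cycle⇒repeated cycle w0≡h))
      where open Tree h h∈

  window⊆V : ∀ {h} → 1 ≤ h × h ≤ 2 * b → InR h
  window⊆V (1≤h , h≤2b) = 1≤h , ≤-trans h≤2b (subst (_≤ N) (*-comm b 2) (∣⇒≤ period∣N))

  MinL : ℕ → Set
  MinL ℓ = ∃ λ h → 1 ≤ h × h ≤ 2 * b × IsL m b d h ℓ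

  minL? : ∀ ℓ → Dec (MinL ℓ)
  minL? ℓ = ∃-bounded? L? (2 * b) λ _ → proj₁ ∘ proj₂
    where
    L? : ∀ h → Dec (1 ≤ h × h ≤ 2 * b × IsL m b d h ℓ)
    L? h with 1 ≤? h ×-dec h ≤? 2 * b
    ... | no  h∉ = no λ (1≤h , h≤2b , _) → h∉ (1≤h , h≤2b)
    ... | yes h∈@(1≤h , h≤2b) with L-exists h (window⊆V h∈)
    ...   | ℓₕ , Lₕ = map′ (λ { refl → 1≤h , h≤2b , Lₕ }) (λ (_ , _ , L) → IsL-unique L Lₕ) (ℓ ≟ ℓₕ)

  minL-exists : ∃ (IsLeast MinL)
  minL-exists = least-exists minL? (1 , s≤s z≤n , s≤s z≤n , proj₂ (L-exists 1 (s≤s z≤n , s≤s z≤n)))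

  minL≤cycle : ∀ {g k} → IsLeast MinL g → HasCycleOfLength m b d k → g ≤ k
  minL≤cycle (_ , g-least) (w , cycle) with cycle-rotate cycle
  ... | w' , cycle' , 1≤h , h≤2b with L-exists (w' 0) (window⊆V (1≤h , h≤2b))
  ...   | ℓ , L = ≤-trans (g-least ℓ (w' 0 , 1≤h , h≤2b , L)) (Tree.L≤cycle (w' 0) (window⊆V (1≤h , h≤2b)) cycle' refl L)

  minL-isGirth : ∀ {g} → IsLeast MinL g → IsGirth m b d g
  minL-isGirth least@((h , 1≤h , h≤2b , L) , _) with Tree.L⇒cycle h (window⊆V (1≤h , h≤2b)) L
  ... | c , c≤g , cycle = subst (HasCycleOfLength m b d) (≤-antisym c≤g (minL≤cycle least cycle)) cycle ,
                          λ _ → minL≤cycle least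

mainTheorem1 : (b m : ℕ) (d : ℕ → ℕ) →
    1 ≤ b → 1 ≤ m → b ∣ m →
    (∀ j → 1 ≤ j → j ≤ b → OddN (d j) × 3 ≤ d j × d j ≤ 2 * m ∸ 3) →
    Cubic m b d →
    (∀ h → 1 ≤ h → h ≤ 2 * b → ∃[ ℓ ] IsL m b d h ℓ) ×
    (∃[ g ] (IsGirth m b d g ×
    IsLeast (λ ℓ → ∃[ h ] (1 ≤ h × h ≤ 2 * b × IsL m b d h ℓ)) g))
mainTheorem1 (suc b') (suc m') d _ _ b∣m chordIndices cubic =
  (λ h 1≤h h≤2b → L-exists h (window⊆V (1≤h , h≤2b))) ,
  proj₁ minL-exists , minL-isGirth (proj₂ minL-exists) , proj₂ minL-exists
  where
  open Girth m' b' d (λ j 1≤j j≤b → proj₁ (chordIndices j 1≤j j≤b)) b∣m (cubic⇒3≤2m {b = suc b'} {d} cubic)
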